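{- Let $\mathbf C$ be a category with finite coproducts. On the category of $\omega$-iteratable monads on $\mathbf C$ and monad morphisms, the construction $\mathbb T\mapsto\mathbb T^\nu$, with unit $\boldsymbol\eta_X=\mathrm{out}^{ -1}\circ T(\mathrm{inl})\colon TX\to T^\nu X$ and multiplication $\boldsymbol\mu_X=\mathrm{coit}\big(T[\mathrm{id},\mathrm{inr}\circ\mathrm{out}^{ -1}]\circ\mathrm{out}\circ\mathrm{out}\big)\colon T^{\nu\nu}X\to T^\nu X$, is a monad.
   Context: For a monad $\mathbb T$ (unit $\eta$, lifting $(-)^*$), $T^\nu X=\nu\gamma.\,T(X+\gamma)$ is the final coalgebra of $\gamma\mapsto T(X+\gamma)$, with structure $\mathrm{out}$ (an isomorphism) and coiteration $\mathrm{coit}$. $\mathbb T^\nu$ is a monad with unit $\mathrm{out}^{ -1}\circ\eta\circ\mathrm{inl}$ and lifting $f^\ddagger$ determined by $\mathrm{out}\circ f^\ddagger=[\mathrm{out}\circ f,\eta\circ\mathrm{inr}\circ f^\ddagger]^*\circ\mathrm{out}$; $T^{\nu\nu}=(T^\nu)^\nu$. On monad morphisms, $\alpha^\nu=\mathrm{coit}(\alpha\circ\mathrm{out})$. A monad is 1-iteratable if $T^\nu$ exists, $(n+1)$-iteratable if $T^\nu$ is $n$-iteratable, $\omega$-iteratable if $n$-iteratable for all $n$. -}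

module Defs where

open import Level using (Level; _⊔_) renaming (suc to lsuc)
open import Relation.Binary using (IsEquivalence)
open import Relation.Binary.PropositionalEquality using (_≡_; refl; subst; trans)
open import Data.Nat using (ℕ; zero; suc)
open import Data.Product using (Σ; _,_; proj₁; proj₂)

record Category (o ℓ e : Level) : Set (lsuc (o ⊔ ℓ ⊔ e)) where
  infix  4 _≈_ _⇒_
  infixr 9 _∘_
  field
    Obj       : Set o
    _⇒_       : Obj → Obj → Set ℓ
    _≈_       : ∀ {A B} → A ⇒ B → A ⇒ B → Set e
    id        : ∀ {A} → A ⇒ A
    _∘_       : ∀ {A B C} → B ⇒ C → A ⇒ B → A ⇒ C
    equiv     : ∀ {A B} → IsEquivalence (_≈_ {A} {B})
    ∘-resp-≈  : ∀ {A B C} {f h : B ⇒ C} {g i : A ⇒ B} → f ≈ h → g ≈ i → f ∘ g ≈ h ∘ i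
    identityˡ : ∀ {A B} {f : A ⇒ B} → id ∘ f ≈ f
    identityʳ : ∀ {A B} {f : A ⇒ B} → f ∘ id ≈ f
    assoc     : ∀ {A B C D} {f : A ⇒ B} {g : B ⇒ C} {h : C ⇒ D} →
                (h ∘ g) ∘ f ≈ h ∘ (g ∘ f)

record FiniteCoproducts {o ℓ e} (𝒞 : Category o ℓ e) : Set (o ⊔ ℓ ⊔ e) where
  open Category 𝒞
  infixr 6 _+_
  field
    𝟘         : Obj
    ¡         : ∀ {A} → 𝟘 ⇒ A
    ¡-unique  : ∀ {A} (f : 𝟘 ⇒ A) → ¡ ≈ f
    _+_       : Obj → Obj → Obj
    inl       : ∀ {A B} → A ⇒ A + B
    inr       : ∀ {A B} → B ⇒ A + B
    [_,_]     : ∀ {A B C} → A ⇒ C → B ⇒ C → A + B ⇒ C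
    inject₁   : ∀ {A B C} {f : A ⇒ C} {g : B ⇒ C} → [ f , g ] ∘ inl ≈ f
    inject₂   : ∀ {A B C} {f : A ⇒ C} {g : B ⇒ C} → [ f , g ] ∘ inr ≈ g
    []-unique : ∀ {A B C} {f : A ⇒ C} {g : B ⇒ C} {h : A + B ⇒ C} →
                h ∘ inl ≈ f → h ∘ inr ≈ g → [ f , g ] ≈ h

  infixr 7 _+₁_
  _+₁_ : ∀ {A B C D} → A ⇒ B → C ⇒ D → A + C ⇒ B + D
  f +₁ g = [ inl ∘ f , inr ∘ g ]

module Theory {o ℓ e} {𝒞 : Category o ℓ e} (FC : FiniteCoproducts 𝒞) where
  open Category 𝒞
  open FiniteCoproducts FC

  record KleisliTriple : Set (o ⊔ ℓ) where
    infix 30 _*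
    field
      T   : Obj → Obj
      η   : ∀ {X} → X ⇒ T X
      _*  : ∀ {X Y} → X ⇒ T Y → T X ⇒ T Y
    T₁ : ∀ {X Y} → X ⇒ Y → T X ⇒ T Y
    T₁ f = (η ∘ f) *

  record IsMonad (M : KleisliTriple) : Set (o ⊔ ℓ ⊔ e) where
    open KleisliTriple M
    field
      *-resp-≈ : ∀ {X Y} {f g : X ⇒ T Y} → f ≈ g → f * ≈ g *
      *-η      : ∀ {X} → (η {X}) * ≈ id
      η-*      : ∀ {X Y} {f : X ⇒ T Y} → f * ∘ η ≈ f
      *-*      : ∀ {X Y Z} {f : X ⇒ T Y} {g : Y ⇒ T Z} → (g * ∘ f) * ≈ g * ∘ f *

  -- families of morphisms T X → S X
  -- (wrapped in a record so that M and N are inferable)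
  record Fam (M N : KleisliTriple) : Set (o ⊔ ℓ) where
    constructor fam
    field
      at : ∀ X → KleisliTriple.T M X ⇒ KleisliTriple.T N X
  open Fam public

  idF : ∀ {M} → Fam M M
  idF = fam λ X → id

  infixr 9 _∘F_
  _∘F_ : ∀ {M N P} → Fam N P → Fam M N → Fam M P
  β ∘F α = fam λ X → at β X ∘ at α X

  infix 4 _≋_
  _≋_ : ∀ {M N} → Fam M N → Fam M N → Set (o ⊔ e)
  α ≋ β = ∀ X → at α X ≈ at β X

  record IsMonadMorphism (M N : KleisliTriple) (α : Fam M N) : Set (o ⊔ ℓ ⊔ e) where
    private
      module M = KleisliTriple M
      module N = KleisliTriple N
    field
      unit : ∀ {X} → at α X ∘ M.η ≈ N.η
      lift : ∀ {X Y} (f : X ⇒ M.T Y) → at α Y ∘ (f M.*) ≈ ((at α Y ∘ f) N.*) ∘ at α X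

  record FinalCoalg (M : KleisliTriple) (X : Obj) : Set (o ⊔ ℓ ⊔ e) where
    open KleisliTriple M
    field
      ν           : Obj
      out         : ν ⇒ T (X + ν)
      coit        : ∀ {A} → A ⇒ T (X + A) → A ⇒ ν
      coit-comm   : ∀ {A} (c : A ⇒ T (X + A)) → out ∘ coit c ≈ T₁ (id +₁ coit c) ∘ c
      coit-unique : ∀ {A} (c : A ⇒ T (X + A)) (h : A ⇒ ν) →
                    out ∘ h ≈ T₁ (id +₁ h) ∘ c → h ≈ coit c
    -- the inverse of out (Lambek)
    out⁻¹ : T (X + ν) ⇒ ν
    out⁻¹ = coit (T₁ (id +₁ out))

  module Nu (M : KleisliTriple) (fc : ∀ X → FinalCoalg M X) where
    open KleisliTriple M
    private
      module F (X : Obj) = FinalCoalg (fc X)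

    Tν : Obj → Obj
    Tν X = F.ν X

    ην : ∀ {X} → X ⇒ Tν X
    ην {X} = F.out⁻¹ X ∘ η ∘ inl

    -- f‡ : the unique map with out ∘ f‡ = [out ∘ f , η ∘ inr ∘ f‡]* ∘ out,
    -- obtained by coiteration on Tν X + Tν Y.
    -- the coalgebra on Tν X + Tν Y used to define f‡
    liftCoalg : ∀ {X Y} → X ⇒ Tν Y → Tν X + Tν Y ⇒ T (Y + (Tν X + Tν Y))
    liftCoalg {X} {Y} f =
      [ [ T₁ (id +₁ inr) ∘ F.out Y ∘ f , η ∘ inr ∘ inl ] * ∘ F.out X
      , T₁ (id +₁ inr) ∘ F.out Y ]

    -- (opaque, so that typechecking does not unfold it; lift-unfold
    -- gives its definition)
    opaque
      lift : ∀ {X Y} → X ⇒ Tν Y → Tν X ⇒ Tν Y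
      lift {X} {Y} f = F.coit Y (liftCoalg f) ∘ inl

      lift-unfold : ∀ {X Y} (f : X ⇒ Tν Y) → lift f ≡ F.coit Y (liftCoalg f) ∘ inl
      lift-unfold f = refl

    triple : KleisliTriple
    triple = record { T = Tν ; η = ην ; _* = lift }

  Choice : KleisliTriple → Set (o ⊔ ℓ ⊔ e)
  Choice M = ∀ X → FinalCoalg M X

  -- ω-iteratability, as structure: chosen final coalgebras for T, and an
  -- ℕ-indexed tower (N₀, c₀), (N₁, c₁), … of monads with chosen final
  -- coalgebras, where N₀ = T^ν and N_{n+1} = (N_n)^ν (computed from c_n).
  -- (A coinductive record would be more direct, but --guardedness is not
  -- available; this is the same data.)
  record ωIter (M : KleisliTriple) : Set (o ⊔ ℓ ⊔ e) where
    field
      fc     : Choice M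
      tower  : ℕ → Σ KleisliTriple Choice
      tower₀ : proj₁ (tower zero) ≡ Nu.triple M fc
      towerₛ : ∀ n → proj₁ (tower (suc n)) ≡ Nu.triple (proj₁ (tower n)) (proj₂ (tower n))
  open ωIter public

  Nu-subst : ∀ {N N′} (p : N ≡ N′) (c : Choice N) →
             Nu.triple N c ≡ Nu.triple N′ (subst Choice p c)
  Nu-subst refl c = refl

  next : ∀ {M} (ω : ωIter M) → ωIter (Nu.triple M (fc ω))
  next ω = record
    { fc     = subst Choice (tower₀ ω) (proj₂ (tower ω zero))
    ; tower  = λ n → tower ω (suc n)
    ; tower₀ = trans (towerₛ ω zero) (Nu-subst (tower₀ ω) (proj₂ (tower ω zero)))
    ; towerₛ = λ n → towerₛ ω (suc n)
    }

  record ωMonad : Set (o ⊔ ℓ ⊔ e) where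
    field
      triple  : KleisliTriple
      isMonad : IsMonad triple
      iter    : ωIter triple
  open ωMonad public

  νT : (M : KleisliTriple) → ωIter M → KleisliTriple
  νT M ω = Nu.triple M (fc ω)

  νmap : ∀ {M N} (ωM : ωIter M) (ωN : ωIter N) → Fam M N → Fam (νT M ωM) (νT N ωN)
  νmap {M} {N} ωM ωN α = fam λ X →
    FinalCoalg.coit (fc ωN X)
      (at α (X + KleisliTriple.T (νT M ωM) X) ∘ FinalCoalg.out (fc ωM X))

  ηfam : ∀ M (ω : ωIter M) → Fam M (νT M ω)
  ηfam M ω = fam λ X → FinalCoalg.out⁻¹ (fc ω X) ∘ KleisliTriple.T₁ M inl

  μfam : ∀ M (ω : ωIter M) → Fam (νT (νT M ω) (next ω)) (νT M ω)
  μfam M ω = fam λ X → F1.coit X (KleisliTriple.T₁ M [ id , inr ∘ F2.out⁻¹ X ] ∘ F1.out (X + F2.ν X) ∘ F2.out X)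
    where
      module F1 (Y : Obj) = FinalCoalg (fc ω Y)
      module F2 (Y : Obj) = FinalCoalg (fc (next ω) Y)

  record NuIsMonad : Set (o ⊔ ℓ ⊔ e) where
    field
      -- the object map lands in monads (ω-iteratability of T^ν is next)
      ν-isMonad : ∀ (A : ωMonad) → IsMonad (νT (triple A) (iter A))
      ν-hom   : ∀ (A B : ωMonad) (α : Fam (triple A) (triple B)) →
                IsMonadMorphism (triple A) (triple B) α →
                IsMonadMorphism (νT (triple A) (iter A)) (νT (triple B) (iter B))
                                (νmap (iter A) (iter B) α)
      ν-resp  : ∀ (A B : ωMonad) (α β : Fam (triple A) (triple B)) →
                IsMonadMorphism (triple A) (triple B) α →
                IsMonadMorphism (triple A) (triple B) β →
                α ≋ β → νmap (iter A) (iter B) α ≋ νmap (iter A) (iter B) β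
      ν-id    : ∀ (A : ωMonad) → νmap (iter A) (iter A) (idF {triple A}) ≋ idF
      ν-∘     : ∀ (A B C : ωMonad) (α : Fam (triple A) (triple B)) (β : Fam (triple B) (triple C)) →
                IsMonadMorphism (triple A) (triple B) α →
                IsMonadMorphism (triple B) (triple C) β →
                νmap (iter A) (iter C) (β ∘F α)
                  ≋ νmap (iter B) (iter C) β ∘F νmap (iter A) (iter B) α
      η-hom   : ∀ (A : ωMonad) →
                IsMonadMorphism (triple A) (νT (triple A) (iter A)) (ηfam (triple A) (iter A))
      η-nat   : ∀ (A B : ωMonad) (α : Fam (triple A) (triple B)) →
                IsMonadMorphism (triple A) (triple B) α →
                νmap (iter A) (iter B) α ∘F ηfam (triple A) (iter A)
                  ≋ ηfam (triple B) (iter B) ∘F α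
      μ-hom   : ∀ (A : ωMonad) →
                IsMonadMorphism (νT (νT (triple A) (iter A)) (next (iter A)))
                                (νT (triple A) (iter A)) (μfam (triple A) (iter A))
      μ-nat   : ∀ (A B : ωMonad) (α : Fam (triple A) (triple B)) →
                IsMonadMorphism (triple A) (triple B) α →
                νmap (iter A) (iter B) α ∘F μfam (triple A) (iter A)
                  ≋ μfam (triple B) (iter B)
                    ∘F νmap (next (iter A)) (next (iter B)) (νmap (iter A) (iter B) α)
      unitˡ   : ∀ (A : ωMonad) →
                μfam (triple A) (iter A)
                  ∘F ηfam (νT (triple A) (iter A)) (next (iter A)) ≋ idF
      unitʳ   : ∀ (A : ωMonad) →
                μfam (triple A) (iter A)
                  ∘F νmap (iter A) (next (iter A)) (ηfam (triple A) (iter A)) ≋ idF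
      assoc-μ : ∀ (A : ωMonad) →
                μfam (triple A) (iter A)
                  ∘F μfam (νT (triple A) (iter A)) (next (iter A))
                ≋ μfam (triple A) (iter A)
                  ∘F νmap (next (next (iter A))) (next (iter A)) (μfam (triple A) (iter A))

module Submission where

-- T^ν X is a final coalgebra, so an equation between maps into it is proved by exhibiting
-- both sides as homomorphisms out of one coalgebra. The lifting f‡ is the solution h of
-- out ∘ h = [ out ∘ f , η ∘ inr ∘ h ]* ∘ out, and with out replaced by any coalgebra c such
-- solutions stay unique, because [ h , id ] is then a homomorphism out of a fixed coalgebra
-- on B + T^ν Y. Since lift g ∘ coit c always solves the equation for c, this yields the monad
-- laws of T^ν and shows that α^ν and μ preserve liftings. For the unit laws, naturality and
-- associativity of μ, the equation out ∘ μ = T [ id + μ , inr ∘ μ ∘ out⁻¹ ] ∘ out ∘ out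
-- turns both sides into homomorphisms out of a common coalgebra, up to identities between
-- copairings.

open import Relation.Binary.Bundles using (Setoid)
open import Relation.Binary.Structures using (IsEquivalence)
open import Relation.Binary.PropositionalEquality as ≡ using ()
import Relation.Binary.Reasoning.Setoid as SetoidReasoning
open import Defs

module NuMonad {o ℓ e} {𝒞 : Category o ℓ e} (FC : FiniteCoproducts 𝒞) where
  open Category 𝒞
  open FiniteCoproducts FC
  open Theory FC

  module _ {A B : Obj} where
    open IsEquivalence (equiv {A} {B}) public using (refl; sym; trans)

    hom-setoid : Setoid ℓ e
    hom-setoid = record { Carrier = A ⇒ B ; _≈_ = _≈_ ; isEquivalence = equiv }

    open SetoidReasoning hom-setoid public

  infixr 4 _⟩∘⟨_ refl⟩∘⟨_
  infixl 5 _⟩∘⟨refl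

  _⟩∘⟨_ : ∀ {A B C} {f h : B ⇒ C} {g i : A ⇒ B} → f ≈ h → g ≈ i → f ∘ g ≈ h ∘ i
  _⟩∘⟨_ = ∘-resp-≈

  refl⟩∘⟨_ : ∀ {A B C} {f : B ⇒ C} {g i : A ⇒ B} → g ≈ i → f ∘ g ≈ f ∘ i
  refl⟩∘⟨ p = refl ⟩∘⟨ p

  _⟩∘⟨refl : ∀ {A B C} {f h : B ⇒ C} {g : A ⇒ B} → f ≈ h → f ∘ g ≈ h ∘ g
  p ⟩∘⟨refl = p ⟩∘⟨ refl

  sym-assoc : ∀ {A B C D} {f : A ⇒ B} {g : B ⇒ C} {h : C ⇒ D} → h ∘ g ∘ f ≈ (h ∘ g) ∘ f
  sym-assoc = sym assoc

  assoc²' : ∀ {A B C D E} {f : A ⇒ B} {g : B ⇒ C} {h : C ⇒ D} {i : D ⇒ E} →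
            (i ∘ h ∘ g) ∘ f ≈ i ∘ h ∘ g ∘ f
  assoc²' = trans assoc (refl⟩∘⟨ assoc)

  assoc³' : ∀ {A B C D E F} {f : A ⇒ B} {g : B ⇒ C} {h : C ⇒ D} {i : D ⇒ E} {j : E ⇒ F} →
            (j ∘ i ∘ h ∘ g) ∘ f ≈ j ∘ i ∘ h ∘ g ∘ f
  assoc³' = trans assoc (refl⟩∘⟨ assoc²')

  pullˡ : ∀ {A B C D} {a : C ⇒ D} {b : B ⇒ C} {c : B ⇒ D} {f : A ⇒ B} →
          a ∘ b ≈ c → a ∘ b ∘ f ≈ c ∘ f
  pullˡ p = trans sym-assoc (p ⟩∘⟨refl)

  pullʳ : ∀ {A B C D} {a : C ⇒ D} {b : B ⇒ C} {f : A ⇒ B} {c : A ⇒ C} →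
          b ∘ f ≈ c → (a ∘ b) ∘ f ≈ a ∘ c
  pullʳ p = trans assoc (refl⟩∘⟨ p)

  cancelˡ : ∀ {A B C} {a : B ⇒ C} {b : C ⇒ B} {f : A ⇒ C} → a ∘ b ≈ id → a ∘ b ∘ f ≈ f
  cancelˡ p = trans (pullˡ p) identityˡ

  []-cong₂ : ∀ {A B C} {f f′ : A ⇒ C} {g g′ : B ⇒ C} → f ≈ f′ → g ≈ g′ → [ f , g ] ≈ [ f′ , g′ ]
  []-cong₂ p q = []-unique (trans inject₁ (sym p)) (trans inject₂ (sym q))

  +-η : ∀ {A B} → [ inl {A} {B} , inr ] ≈ id
  +-η = []-unique identityˡ identityˡ

  ∘-distribˡ-[] : ∀ {A B C D} {f : A ⇒ C} {g : B ⇒ C} {h : C ⇒ D} →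
                  h ∘ [ f , g ] ≈ [ h ∘ f , h ∘ g ]
  ∘-distribˡ-[] = sym ([]-unique (pullʳ inject₁) (pullʳ inject₂))

  []∘+₁ : ∀ {A B C D E} {f : A ⇒ B} {g : C ⇒ D} {h : B ⇒ E} {k : D ⇒ E} →
          [ h , k ] ∘ (f +₁ g) ≈ [ h ∘ f , k ∘ g ]
  []∘+₁ = trans ∘-distribˡ-[] ([]-cong₂ (pullˡ inject₁) (pullˡ inject₂))

  +₁-cong₂ : ∀ {A B C D} {f f′ : A ⇒ B} {g g′ : C ⇒ D} → f ≈ f′ → g ≈ g′ → f +₁ g ≈ f′ +₁ g′
  +₁-cong₂ p q = []-cong₂ (refl⟩∘⟨ p) (refl⟩∘⟨ q)

  +₁-identity : ∀ {A B} → id {A} +₁ id {B} ≈ id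
  +₁-identity = trans ([]-cong₂ identityʳ identityʳ) +-η

  +₁∘+₁ : ∀ {A B C D E F} {f : A ⇒ B} {g : C ⇒ D} {h : B ⇒ E} {k : D ⇒ F} →
          (h +₁ k) ∘ (f +₁ g) ≈ h ∘ f +₁ k ∘ g
  +₁∘+₁ = trans []∘+₁ ([]-cong₂ assoc assoc)

  +₁∘inr∘ : ∀ {A B C D E} {f : A ⇒ B} {g : C ⇒ D} {x : E ⇒ C} → (f +₁ g) ∘ inr ∘ x ≈ inr ∘ g ∘ x
  +₁∘inr∘ = trans (pullˡ inject₂) assoc

  id+₁∘[id,inr∘] : ∀ {A B C D} {h : B ⇒ D} {k : C ⇒ B} →
                   (id {A} +₁ h) ∘ [ id , inr ∘ k ] ≈ [ id +₁ h , inr ∘ h ∘ k ]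
  id+₁∘[id,inr∘] = trans ∘-distribˡ-[] ([]-cong₂ identityʳ +₁∘inr∘)

  id+₁∘id+₁ : ∀ {A B C D} {f : C ⇒ D} {g : B ⇒ C} → (id {A} +₁ f) ∘ (id +₁ g) ≈ id +₁ f ∘ g
  id+₁∘id+₁ = trans +₁∘+₁ (+₁-cong₂ identityˡ refl)

  module KleisliProperties {M : KleisliTriple} (isM : IsMonad M) where
    open KleisliTriple M
    open IsMonad isM

    T₁-resp : ∀ {X Y} {f g : X ⇒ Y} → f ≈ g → T₁ f ≈ T₁ g
    T₁-resp p = *-resp-≈ (refl⟩∘⟨ p)

    T₁-identity : ∀ {X} → T₁ (id {X}) ≈ id
    T₁-identity = trans (*-resp-≈ identityʳ) *-η

    *∘* : ∀ {X Y Z} {f : X ⇒ T Y} {g : Y ⇒ T Z} → g * ∘ f * ≈ (g * ∘ f) *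
    *∘* = sym *-*

    *∘T₁ : ∀ {X Y Z} {f : Y ⇒ T Z} {h : X ⇒ Y} → f * ∘ T₁ h ≈ (f ∘ h) *
    *∘T₁ = trans *∘* (*-resp-≈ (pullˡ η-*))

    T₁∘T₁ : ∀ {X Y Z} {f : X ⇒ Y} {g : Y ⇒ Z} → T₁ g ∘ T₁ f ≈ T₁ (g ∘ f)
    T₁∘T₁ = trans *∘T₁ (*-resp-≈ assoc)

    T₁∘η∘ : ∀ {W X Y} {f : X ⇒ Y} {x : W ⇒ X} → T₁ f ∘ η ∘ x ≈ η ∘ f ∘ x
    T₁∘η∘ = trans (pullˡ η-*) assoc

    T₁id+₁id : ∀ {A B} → T₁ (id {A} +₁ id {B}) ≈ id
    T₁id+₁id = trans (T₁-resp +₁-identity) T₁-identity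

    T₁id+₁∘T₁id+₁ : ∀ {X A B C} {f : B ⇒ C} {g : A ⇒ B} →
                    T₁ (id {X} +₁ f) ∘ T₁ (id +₁ g) ≈ T₁ (id +₁ f ∘ g)
    T₁id+₁∘T₁id+₁ = trans T₁∘T₁ (T₁-resp id+₁∘id+₁)

    T₁id+₁-retract : ∀ {X A B} {r : B ⇒ A} {s : A ⇒ B} → r ∘ s ≈ id →
                     T₁ (id {X} +₁ r) ∘ T₁ (id +₁ s) ≈ id
    T₁id+₁-retract p = trans T₁id+₁∘T₁id+₁ (trans (T₁-resp (+₁-cong₂ refl p)) T₁id+₁id)

  module FinalCoalgProperties {M : KleisliTriple} (isM : IsMonad M) {X : Obj} (F : FinalCoalg M X) where
    open KleisliTriple M
    open KleisliProperties isM
    open FinalCoalg F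

    IsHom : ∀ {A} → A ⇒ T (X + A) → A ⇒ ν → Set e
    IsHom c h = out ∘ h ≈ T₁ (id +₁ h) ∘ c

    hom-unique : ∀ {A} (c : A ⇒ T (X + A)) {h k : A ⇒ ν} → IsHom c h → IsHom c k → h ≈ k
    hom-unique c {h} {k} p q = trans (coit-unique c h p) (sym (coit-unique c k q))

    coit-resp : ∀ {A} {c d : A ⇒ T (X + A)} → c ≈ d → coit c ≈ coit d
    coit-resp {c = c} {d} p = coit-unique d (coit c) (trans (coit-comm c) (refl⟩∘⟨ p))

    id-isHom : IsHom out id
    id-isHom = begin
      out ∘ id            ≈⟨ identityʳ ⟩
      out                 ≈⟨ identityˡ ⟨
      id ∘ out            ≈⟨ T₁id+₁id ⟩∘⟨refl ⟨
      T₁ (id +₁ id) ∘ out ∎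

    coit-out : coit out ≈ id
    coit-out = sym (coit-unique out id id-isHom)

    coit-fusion : ∀ {A B} {a : A ⇒ T (X + A)} {b : B ⇒ T (X + B)} {h : A ⇒ B} →
                  b ∘ h ≈ T₁ (id +₁ h) ∘ a → coit b ∘ h ≈ coit a
    coit-fusion {a = a} {b} {h} p = coit-unique a (coit b ∘ h) (begin
      out ∘ coit b ∘ h                     ≈⟨ pullˡ (coit-comm b) ⟩
      (T₁ (id +₁ coit b) ∘ b) ∘ h          ≈⟨ pullʳ p ⟩
      T₁ (id +₁ coit b) ∘ T₁ (id +₁ h) ∘ a ≈⟨ pullˡ T₁id+₁∘T₁id+₁ ⟩
      T₁ (id +₁ coit b ∘ h) ∘ a            ∎)

    out⁻¹∘out : out⁻¹ ∘ out ≈ id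
    out⁻¹∘out = trans (coit-fusion refl) coit-out

    out∘out⁻¹ : out ∘ out⁻¹ ≈ id
    out∘out⁻¹ = trans (coit-comm _) (T₁id+₁-retract out⁻¹∘out)

    out-injective : ∀ {A} {h k : A ⇒ ν} → out ∘ h ≈ out ∘ k → h ≈ k
    out-injective {h = h} {k} p = begin
      h               ≈⟨ cancelˡ out⁻¹∘out ⟨
      out⁻¹ ∘ out ∘ h ≈⟨ refl⟩∘⟨ p ⟩
      out⁻¹ ∘ out ∘ k ≈⟨ cancelˡ out⁻¹∘out ⟩
      k               ∎

    out-transpose : ∀ {A} {h : A ⇒ ν} {k : A ⇒ T (X + ν)} → out ∘ h ≈ k → h ≈ out⁻¹ ∘ k
    out-transpose p = out-injective (trans p (sym (cancelˡ out∘out⁻¹)))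

  module NuProperties {M : KleisliTriple} (isM : IsMonad M) (fc : Choice M) where
    open KleisliTriple M
    open IsMonad isM
    open KleisliProperties isM
    open Nu M fc public
    module C (X : Obj) = FinalCoalgProperties isM (fc X)
    open module F (X : Obj) = FinalCoalg (fc X) public using (out; out⁻¹; coit; coit-comm)

    out∘ην : ∀ {X} → out X ∘ ην ≈ η ∘ inl
    out∘ην {X} = cancelˡ (C.out∘out⁻¹ X)

    module _ {B X Y : Obj} (c : B ⇒ T (X + B)) (g : X ⇒ Tν Y) where
      Solves : B ⇒ Tν Y → Set e
      Solves h = out Y ∘ h ≈ [ out Y ∘ g , η ∘ inr ∘ h ] * ∘ c

      solutionCoalg : B + Tν Y ⇒ T (Y + (B + Tν Y))
      solutionCoalg =
        [ [ T₁ (id +₁ inr) ∘ out Y ∘ g , η ∘ inr ∘ inl ] * ∘ c , T₁ (id +₁ inr) ∘ out Y ]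

      T₁id+₁∘solutionCoalg : (k : B + Tν Y ⇒ Tν Y) → k ∘ inr ≈ id →
        T₁ (id +₁ k) ∘ solutionCoalg ≈ [ [ out Y ∘ g , η ∘ inr ∘ k ∘ inl ] * ∘ c , out Y ]
      T₁id+₁∘solutionCoalg k k∘inr≈id =
        trans ∘-distribˡ-[] ([]-cong₂ (trans (pullˡ *∘*) (*-resp-≈ on-c ⟩∘⟨refl)) (cancelˡ retract))
        where
          retract : T₁ (id +₁ k) ∘ T₁ (id +₁ inr) ≈ id
          retract = T₁id+₁-retract k∘inr≈id

          on-c : T₁ (id +₁ k) ∘ [ T₁ (id +₁ inr) ∘ out Y ∘ g , η ∘ inr ∘ inl ] ≈
                 [ out Y ∘ g , η ∘ inr ∘ k ∘ inl ]
          on-c = trans ∘-distribˡ-[] ([]-cong₂ (cancelˡ retract) (trans T₁∘η∘ (refl⟩∘⟨ +₁∘inr∘)))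

      solution-isHom : ∀ {h} → Solves h → C.IsHom Y solutionCoalg [ h , id ]
      solution-isHom {h} p = begin
        out Y ∘ [ h , id ]
          ≈⟨ ∘-distribˡ-[] ⟩
        [ out Y ∘ h , out Y ∘ id ]
          ≈⟨ []-cong₂ p identityʳ ⟩
        [ [ out Y ∘ g , η ∘ inr ∘ h ] * ∘ c , out Y ]
          ≈⟨ []-cong₂ (*-resp-≈ ([]-cong₂ refl (refl⟩∘⟨ refl⟩∘⟨ inject₁)) ⟩∘⟨refl) refl ⟨
        [ [ out Y ∘ g , η ∘ inr ∘ [ h , id ] ∘ inl ] * ∘ c , out Y ]
          ≈⟨ T₁id+₁∘solutionCoalg [ h , id ] inject₂ ⟨
        T₁ (id +₁ [ h , id ]) ∘ solutionCoalg ∎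

      solution-unique : ∀ {h h′} → Solves h → Solves h′ → h ≈ h′
      solution-unique {h} {h′} p q = begin
        h                 ≈⟨ inject₁ ⟨
        [ h , id ] ∘ inl  ≈⟨ C.hom-unique Y solutionCoalg (solution-isHom p) (solution-isHom q) ⟩∘⟨refl ⟩
        [ h′ , id ] ∘ inl ≈⟨ inject₁ ⟩
        h′                ∎

    lift-solves : ∀ {X Y} (f : X ⇒ Tν Y) → Solves (out X) f (lift f)
    lift-solves {X} {Y} f = ≡.subst (Solves (out X) f) (≡.sym (lift-unfold f)) (begin
      out Y ∘ C₀ ∘ inl
        ≈⟨ pullˡ (coit-comm Y _) ⟩
      (T₁ (id +₁ C₀) ∘ liftCoalg f) ∘ inl
        ≈⟨ T₁id+₁∘solutionCoalg (out X) f C₀ C₀∘inr≈id ⟩∘⟨refl ⟩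
      [ [ out Y ∘ f , η ∘ inr ∘ C₀ ∘ inl ] * ∘ out X , out Y ] ∘ inl
        ≈⟨ inject₁ ⟩
      [ out Y ∘ f , η ∘ inr ∘ C₀ ∘ inl ] * ∘ out X ∎)
      where
        C₀ : Tν X + Tν Y ⇒ Tν Y
        C₀ = coit Y (liftCoalg f)

        C₀∘inr≈id : C₀ ∘ inr ≈ id
        C₀∘inr≈id = C.hom-unique Y (out Y) (begin
          out Y ∘ C₀ ∘ inr                           ≈⟨ pullˡ (coit-comm Y _) ⟩
          (T₁ (id +₁ C₀) ∘ liftCoalg f) ∘ inr        ≈⟨ pullʳ inject₂ ⟩
          T₁ (id +₁ C₀) ∘ T₁ (id +₁ inr) ∘ out Y     ≈⟨ pullˡ T₁id+₁∘T₁id+₁ ⟩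
          T₁ (id +₁ C₀ ∘ inr) ∘ out Y                ∎) (C.id-isHom Y)

    lift-unique : ∀ {X Y} {f : X ⇒ Tν Y} {h : Tν X ⇒ Tν Y} → Solves (out X) f h → h ≈ lift f
    lift-unique {f = f} p = solution-unique _ f p (lift-solves f)

    lift∘-solves : ∀ {B X Y Z} {c : B ⇒ T (X + B)} {f : X ⇒ Tν Y} {h : B ⇒ Tν Y} (g : Y ⇒ Tν Z) →
                   Solves c f h → Solves c (lift g ∘ f) (lift g ∘ h)
    lift∘-solves {Y = Y} {Z} {c} {f} {h} g p = begin
      out Z ∘ lift g ∘ h                                  ≈⟨ pullˡ (lift-solves g) ⟩
      (k * ∘ out Y) ∘ h                                   ≈⟨ pullʳ p ⟩
      k * ∘ [ out Y ∘ f , η ∘ inr ∘ h ] * ∘ c             ≈⟨ pullˡ *∘* ⟩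
      (k * ∘ [ out Y ∘ f , η ∘ inr ∘ h ]) * ∘ c           ≈⟨ *-resp-≈ on-[f,h] ⟩∘⟨refl ⟩
      [ out Z ∘ lift g ∘ f , η ∘ inr ∘ lift g ∘ h ] * ∘ c ∎
      where
        k = [ out Z ∘ g , η ∘ inr ∘ lift g ]

        on-[f,h] : k * ∘ [ out Y ∘ f , η ∘ inr ∘ h ] ≈ [ out Z ∘ lift g ∘ f , η ∘ inr ∘ lift g ∘ h ]
        on-[f,h] = trans ∘-distribˡ-[] ([]-cong₂
          (trans (pullˡ (sym (lift-solves g))) assoc)
          (trans (pullˡ η-*) (trans (pullˡ inject₂) assoc²')))

    lift∘coit-solves : ∀ {B X Y} (c : B ⇒ T (X + B)) (g : X ⇒ Tν Y) → Solves c g (lift g ∘ coit X c)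
    lift∘coit-solves {X = X} {Y} c g = begin
      out Y ∘ lift g ∘ coit X c                         ≈⟨ pullˡ (lift-solves g) ⟩
      (k * ∘ out X) ∘ coit X c                          ≈⟨ pullʳ (coit-comm X c) ⟩
      k * ∘ T₁ (id +₁ coit X c) ∘ c                     ≈⟨ pullˡ *∘T₁ ⟩
      (k ∘ (id +₁ coit X c)) * ∘ c                      ≈⟨ *-resp-≈ (trans []∘+₁ ([]-cong₂ identityʳ assoc²')) ⟩∘⟨refl ⟩
      [ out Y ∘ g , η ∘ inr ∘ lift g ∘ coit X c ] * ∘ c ∎
      where
        k = [ out Y ∘ g , η ∘ inr ∘ lift g ]

    lift∘out⁻¹ : ∀ {X Y} (f : X ⇒ Tν Y) → lift f ∘ out⁻¹ X ≈ out⁻¹ Y ∘ [ out Y ∘ f , η ∘ inr ∘ lift f ] *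
    lift∘out⁻¹ {X} {Y} f = C.out-transpose Y (trans (pullˡ (lift-solves f)) (trans assoc
      (trans (refl⟩∘⟨ C.out∘out⁻¹ X) identityʳ)))

    ην-solves : ∀ {X} → Solves (out X) ην id
    ην-solves {X} = begin
      out X ∘ id
        ≈⟨ identityʳ ⟩
      out X
        ≈⟨ trans (*-η ⟩∘⟨refl) identityˡ ⟨
      η * ∘ out X
        ≈⟨ *-resp-≈ (trans (refl⟩∘⟨ +-η) identityʳ) ⟩∘⟨refl ⟨
      (η ∘ [ inl , inr ]) * ∘ out X
        ≈⟨ *-resp-≈ (trans ∘-distribˡ-[] ([]-cong₂ (sym out∘ην) (refl⟩∘⟨ sym identityʳ))) ⟩∘⟨refl ⟩
      [ out X ∘ ην , η ∘ inr ∘ id ] * ∘ out X ∎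

    lift∘ην : ∀ {X Y} (f : X ⇒ Tν Y) → lift f ∘ ην ≈ f
    lift∘ην {X} {Y} f = C.out-injective Y (begin
      out Y ∘ lift f ∘ ην                               ≈⟨ pullˡ (lift-solves f) ⟩
      ([ out Y ∘ f , η ∘ inr ∘ lift f ] * ∘ out X) ∘ ην ≈⟨ pullʳ out∘ην ⟩
      [ out Y ∘ f , η ∘ inr ∘ lift f ] * ∘ η ∘ inl      ≈⟨ pullˡ η-* ⟩
      [ out Y ∘ f , η ∘ inr ∘ lift f ] ∘ inl            ≈⟨ inject₁ ⟩
      out Y ∘ f                                         ∎)

    Tν-isMonad : IsMonad (Nu.triple M fc)
    Tν-isMonad = record
      { *-resp-≈ = λ {_} {_} {f} {g} p →
          lift-unique (trans (lift-solves f) (*-resp-≈ ([]-cong₂ (refl⟩∘⟨ p) refl) ⟩∘⟨refl))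
      ; *-η      = sym (lift-unique ην-solves)
      ; η-*      = lift∘ην _
      ; *-*      = λ {_} {_} {_} {f} {g} → sym (lift-unique (lift∘-solves g (lift-solves f)))
      }

    Tν₁ : ∀ {X Y} → X ⇒ Y → Tν X ⇒ Tν Y
    Tν₁ h = lift (ην ∘ h)

    out∘Tν₁ : ∀ {X Y} (h : X ⇒ Y) → out Y ∘ Tν₁ h ≈ T₁ (h +₁ Tν₁ h) ∘ out X
    out∘Tν₁ {X} {Y} h = begin
      out Y ∘ Tν₁ h
        ≈⟨ lift-solves (ην ∘ h) ⟩
      [ out Y ∘ ην ∘ h , η ∘ inr ∘ Tν₁ h ] * ∘ out X
        ≈⟨ *-resp-≈ ([]-cong₂ (trans (pullˡ out∘ην) assoc) refl) ⟩∘⟨refl ⟩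
      [ η ∘ inl ∘ h , η ∘ inr ∘ Tν₁ h ] * ∘ out X
        ≈⟨ *-resp-≈ ∘-distribˡ-[] ⟩∘⟨refl ⟨
      T₁ (h +₁ Tν₁ h) ∘ out X ∎

    embed : ∀ X → T X ⇒ Tν X
    embed X = out⁻¹ X ∘ T₁ inl

    out∘embed : ∀ {X} → out X ∘ embed X ≈ T₁ inl
    out∘embed {X} = cancelˡ (C.out∘out⁻¹ X)

    embed-isMonadMorphism : IsMonadMorphism M (Nu.triple M fc) (fam embed)
    embed-isMonadMorphism = record
      { unit = pullʳ η-*
      ; lift = λ {X} {Y} f → C.out-injective Y (begin
          out Y ∘ embed Y ∘ f *
            ≈⟨ pullˡ out∘embed ⟩
          T₁ inl ∘ f *
            ≈⟨ *∘* ⟩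
          (T₁ inl ∘ f) *
            ≈⟨ *-resp-≈ (pullˡ out∘embed) ⟨
          (out Y ∘ embed Y ∘ f) *
            ≈⟨ *-resp-≈ inject₁ ⟨
          ([ out Y ∘ embed Y ∘ f , η ∘ inr ∘ lift (embed Y ∘ f) ] ∘ inl) *
            ≈⟨ *∘T₁ ⟨
          [ out Y ∘ embed Y ∘ f , η ∘ inr ∘ lift (embed Y ∘ f) ] * ∘ T₁ inl
            ≈⟨ pullʳ out∘embed ⟨
          ([ out Y ∘ embed Y ∘ f , η ∘ inr ∘ lift (embed Y ∘ f) ] * ∘ out X) ∘ embed X
            ≈⟨ pullˡ (lift-solves _) ⟨
          out Y ∘ lift (embed Y ∘ f) ∘ embed X ∎)
      }

  module MonadMorphismProperties {M S : KleisliTriple} (isS : IsMonad S)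
                                 (α : Fam M S) (hα : IsMonadMorphism M S α) where
    private
      module M = KleisliTriple M
      module S = KleisliTriple S
    open IsMonadMorphism hα

    α∘η∘ : ∀ {W X} {x : W ⇒ X} → at α X ∘ M.η ∘ x ≈ S.η ∘ x
    α∘η∘ = pullˡ unit

    α∘*∘ : ∀ {W X Y} {f : X ⇒ M.T Y} {x : W ⇒ M.T X} →
           at α Y ∘ f M.* ∘ x ≈ (at α Y ∘ f) S.* ∘ at α X ∘ x
    α∘*∘ {f = f} = trans (pullˡ (lift f)) assoc

    α-natural : ∀ {X Y} (h : X ⇒ Y) → at α Y ∘ M.T₁ h ≈ S.T₁ h ∘ at α X
    α-natural h = trans (lift (M.η ∘ h)) (IsMonad.*-resp-≈ isS (pullˡ unit) ⟩∘⟨refl)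

    α-natural∘ : ∀ {W X Y} {h : X ⇒ Y} {x : W ⇒ M.T X} → at α Y ∘ M.T₁ h ∘ x ≈ S.T₁ h ∘ at α X ∘ x
    α-natural∘ {h = h} = trans (pullˡ (α-natural h)) assoc

  module NuMap {M S : KleisliTriple} (isM : IsMonad M) (isS : IsMonad S)
               (cM : Choice M) (cS : Choice S) where
    private
      module M = KleisliTriple M
      module S = KleisliTriple S
      module NM = NuProperties isM cM
      module NS = NuProperties isS cS
    open KleisliProperties isS
    open IsMonad isS

    -- νmap, for arbitrary chosen final coalgebras rather than ω-iteratability structures
    _^ν : Fam M S → Fam (Nu.triple M cM) (Nu.triple S cS)
    α ^ν = fam λ X → NS.coit X (at α _ ∘ NM.out X)

    ^ν-resp : ∀ {α β : Fam M S} → α ≋ β → α ^ν ≋ β ^ν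
    ^ν-resp p X = NS.C.coit-resp X (p _ ⟩∘⟨refl)

    module _ (α : Fam M S) (hα : IsMonadMorphism M S α) where
      open MonadMorphismProperties isS α hα

      private
        αν : ∀ X → NM.Tν X ⇒ NS.Tν X
        αν = at (α ^ν)

      out∘^ν : ∀ {X} → NS.out X ∘ αν X ≈ S.T₁ (id +₁ αν X) ∘ at α _ ∘ NM.out X
      out∘^ν {X} = NS.coit-comm X _

      out∘^ν∘ : ∀ {W X} {x : W ⇒ NM.Tν X} →
                NS.out X ∘ αν X ∘ x ≈ S.T₁ (id +₁ αν X) ∘ at α _ ∘ NM.out X ∘ x
      out∘^ν∘ = trans (pullˡ out∘^ν) assoc²'

      ^ν∘out⁻¹ : ∀ {X} → αν X ∘ NM.out⁻¹ X ≈ NS.out⁻¹ X ∘ S.T₁ (id +₁ αν X) ∘ at α _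
      ^ν∘out⁻¹ {X} = NS.C.out-transpose X (begin
        NS.out X ∘ αν X ∘ NM.out⁻¹ X                          ≈⟨ out∘^ν∘ ⟩
        S.T₁ (id +₁ αν X) ∘ at α _ ∘ NM.out X ∘ NM.out⁻¹ X    ≈⟨ refl⟩∘⟨ refl⟩∘⟨ NM.C.out∘out⁻¹ X ⟩
        S.T₁ (id +₁ αν X) ∘ at α _ ∘ id                       ≈⟨ refl⟩∘⟨ identityʳ ⟩
        S.T₁ (id +₁ αν X) ∘ at α _                            ∎)

      ^ν∘coit : ∀ {A X} (c : A ⇒ M.T (X + A)) → αν X ∘ NM.coit X c ≈ NS.coit X (at α _ ∘ c)
      ^ν∘coit {X = X} c = NS.F.coit-unique X _ _ (begin
        NS.out X ∘ αν X ∘ NM.coit X c                              ≈⟨ out∘^ν∘ ⟩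
        S.T₁ (id +₁ αν X) ∘ at α _ ∘ NM.out X ∘ NM.coit X c        ≈⟨ refl⟩∘⟨ refl⟩∘⟨ NM.coit-comm X c ⟩
        S.T₁ (id +₁ αν X) ∘ at α _ ∘ M.T₁ (id +₁ NM.coit X c) ∘ c  ≈⟨ refl⟩∘⟨ α-natural∘ ⟩
        S.T₁ (id +₁ αν X) ∘ S.T₁ (id +₁ NM.coit X c) ∘ at α _ ∘ c  ≈⟨ pullˡ T₁id+₁∘T₁id+₁ ⟩
        S.T₁ (id +₁ αν X ∘ NM.coit X c) ∘ at α _ ∘ c               ∎)

      ^ν-unit : ∀ {X} → αν X ∘ NM.ην ≈ NS.ην
      ^ν-unit {X} = begin
        αν X ∘ NM.out⁻¹ X ∘ M.η ∘ inl                            ≈⟨ pullˡ ^ν∘out⁻¹ ⟩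
        (NS.out⁻¹ X ∘ S.T₁ (id +₁ αν X) ∘ at α _) ∘ M.η ∘ inl    ≈⟨ assoc²' ⟩
        NS.out⁻¹ X ∘ S.T₁ (id +₁ αν X) ∘ at α _ ∘ M.η ∘ inl      ≈⟨ refl⟩∘⟨ refl⟩∘⟨ α∘η∘ ⟩
        NS.out⁻¹ X ∘ S.T₁ (id +₁ αν X) ∘ S.η ∘ inl               ≈⟨ refl⟩∘⟨ T₁∘η∘ ⟩
        NS.out⁻¹ X ∘ S.η ∘ (id +₁ αν X) ∘ inl                    ≈⟨ refl⟩∘⟨ refl⟩∘⟨ trans inject₁ identityʳ ⟩
        NS.out⁻¹ X ∘ S.η ∘ inl                                   ∎

      ^ν∘lift-solves : ∀ {X Y} (f : X ⇒ NM.Tν Y) →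
                       NS.Solves (at α _ ∘ NM.out X) (αν Y ∘ f) (αν Y ∘ NM.lift f)
      ^ν∘lift-solves {X} {Y} f = begin
        NS.out Y ∘ αν Y ∘ NM.lift f                              ≈⟨ out∘^ν∘ ⟩
        S.T₁ (id +₁ αν Y) ∘ at α _ ∘ NM.out Y ∘ NM.lift f        ≈⟨ refl⟩∘⟨ refl⟩∘⟨ NM.lift-solves f ⟩
        S.T₁ (id +₁ αν Y) ∘ at α _ ∘ k M.* ∘ NM.out X            ≈⟨ refl⟩∘⟨ α∘*∘ ⟩
        S.T₁ (id +₁ αν Y) ∘ (at α _ ∘ k) S.* ∘ at α _ ∘ NM.out X ≈⟨ pullˡ *∘* ⟩
        (S.T₁ (id +₁ αν Y) ∘ at α _ ∘ k) S.* ∘ at α _ ∘ NM.out X ≈⟨ *-resp-≈ on-k ⟩∘⟨refl ⟩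
        [ NS.out Y ∘ αν Y ∘ f , S.η ∘ inr ∘ αν Y ∘ NM.lift f ] S.* ∘ at α _ ∘ NM.out X ∎
        where
          k = [ NM.out Y ∘ f , M.η ∘ inr ∘ NM.lift f ]

          on-k : S.T₁ (id +₁ αν Y) ∘ at α _ ∘ k ≈ [ NS.out Y ∘ αν Y ∘ f , S.η ∘ inr ∘ αν Y ∘ NM.lift f ]
          on-k = trans (refl⟩∘⟨ ∘-distribˡ-[]) (trans ∘-distribˡ-[] ([]-cong₂
            (sym out∘^ν∘)
            (trans (refl⟩∘⟨ α∘η∘) (trans T₁∘η∘ (refl⟩∘⟨ +₁∘inr∘)))))

      ^ν-lift : ∀ {X Y} (f : X ⇒ NM.Tν Y) → αν Y ∘ NM.lift f ≈ NS.lift (αν Y ∘ f) ∘ αν X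
      ^ν-lift f = NS.solution-unique _ _ (^ν∘lift-solves f) (NS.lift∘coit-solves _ _)

      ^ν-isMonadMorphism : IsMonadMorphism (Nu.triple M cM) (Nu.triple S cS) (α ^ν)
      ^ν-isMonadMorphism = record { unit = ^ν-unit ; lift = ^ν-lift }

      ^ν∘embed : ∀ {X} → αν X ∘ NM.embed X ≈ NS.embed X ∘ at α X
      ^ν∘embed {X} = begin
        αν X ∘ NM.out⁻¹ X ∘ M.T₁ inl                              ≈⟨ pullˡ ^ν∘out⁻¹ ⟩
        (NS.out⁻¹ X ∘ S.T₁ (id +₁ αν X) ∘ at α _) ∘ M.T₁ inl      ≈⟨ assoc²' ⟩
        NS.out⁻¹ X ∘ S.T₁ (id +₁ αν X) ∘ at α _ ∘ M.T₁ inl        ≈⟨ refl⟩∘⟨ refl⟩∘⟨ α-natural inl ⟩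
        NS.out⁻¹ X ∘ S.T₁ (id +₁ αν X) ∘ S.T₁ inl ∘ at α X        ≈⟨ refl⟩∘⟨ pullˡ T₁∘T₁ ⟩
        NS.out⁻¹ X ∘ S.T₁ ((id +₁ αν X) ∘ inl) ∘ at α X           ≈⟨ refl⟩∘⟨ T₁-resp (trans inject₁ identityʳ) ⟩∘⟨refl ⟩
        NS.out⁻¹ X ∘ S.T₁ inl ∘ at α X                            ≈⟨ sym-assoc ⟩
        NS.embed X ∘ at α X                                       ∎

  module _ {M : KleisliTriple} (isM : IsMonad M) (cM : Choice M) where
    open NuMap isM isM cM cM

    ^ν-identity : idF ^ν ≋ idF
    ^ν-identity X = trans (C.coit-resp X identityˡ) (C.coit-out X)
      where module C X = FinalCoalgProperties isM (cM X)

  module _ {M S U : KleisliTriple} (isM : IsMonad M) (isS : IsMonad S) (isU : IsMonad U)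
           (cM : Choice M) (cS : Choice S) (cU : Choice U) where
    private
      module MS = NuMap isM isS cM cS
      module SU = NuMap isS isU cS cU
      module MU = NuMap isM isU cM cU

    ^ν-∘ : (α : Fam M S) (β : Fam S U) → IsMonadMorphism S U β → (β ∘F α) MU.^ν ≋ β SU.^ν ∘F α MS.^ν
    ^ν-∘ α β hβ X = sym (trans (SU.^ν∘coit β hβ _) (FinalCoalgProperties.coit-resp isU (cU X) (sym assoc)))

  module NuMultiplication {M : KleisliTriple} (isM : IsMonad M)
                          (c₁ : Choice M) (c₂ : Choice (Nu.triple M c₁)) where
    open KleisliTriple M
    open IsMonad isM
    open KleisliProperties isM
    module N₁ = NuProperties isM c₁
    module N₂ = NuProperties N₁.Tν-isMonad c₂
    open N₁ using (Tν; Tν₁) renaming (out to out₁; out⁻¹ to out₁⁻¹)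
    open N₂ using () renaming (Tν to Tνν; out to out₂; out⁻¹ to out₂⁻¹)

    μ-coalg : ∀ X → Tνν X ⇒ T (X + Tνν X)
    μ-coalg X = T₁ [ id , inr ∘ out₂⁻¹ X ] ∘ out₁ (X + Tνν X) ∘ out₂ X

    μ : ∀ X → Tνν X ⇒ Tν X
    μ X = N₁.coit X (μ-coalg X)

    μ-fam : Fam (Nu.triple (Nu.triple M c₁) c₂) (Nu.triple M c₁)
    μ-fam = fam μ

    μ-step : ∀ X → (X + Tνν X) + Tν (X + Tνν X) ⇒ X + Tν X
    μ-step X = [ id +₁ μ X , inr ∘ μ X ∘ out₂⁻¹ X ]

    out∘μ : ∀ {X} → out₁ X ∘ μ X ≈ T₁ (μ-step X) ∘ out₁ _ ∘ out₂ X
    out∘μ {X} = trans (N₁.coit-comm X _) (pullˡ (trans T₁∘T₁ (T₁-resp id+₁∘[id,inr∘])))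

    out∘μ∘ : ∀ {W X} {x : W ⇒ Tνν X} → out₁ X ∘ μ X ∘ x ≈ T₁ (μ-step X) ∘ out₁ _ ∘ out₂ X ∘ x
    out∘μ∘ = trans (pullˡ out∘μ) assoc²'

    μ-step∘+₁ : ∀ {X A B} {f : A ⇒ X + Tνν X} {g : B ⇒ Tν (X + Tνν X)} →
                μ-step X ∘ (f +₁ g) ≈ [ (id +₁ μ X) ∘ f , inr ∘ μ X ∘ out₂⁻¹ X ∘ g ]
    μ-step∘+₁ = trans []∘+₁ ([]-cong₂ refl assoc²')

    μ∘out⁻¹ : ∀ {X} → μ X ∘ out₂⁻¹ X ∘ out₁⁻¹ _ ≈ out₁⁻¹ X ∘ T₁ (μ-step X)
    μ∘out⁻¹ {X} = N₁.C.out-transpose X (begin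
      out₁ X ∘ μ X ∘ out₂⁻¹ X ∘ out₁⁻¹ _                    ≈⟨ out∘μ∘ ⟩
      T₁ (μ-step X) ∘ out₁ _ ∘ out₂ X ∘ out₂⁻¹ X ∘ out₁⁻¹ _ ≈⟨ refl⟩∘⟨ refl⟩∘⟨ cancelˡ (N₂.C.out∘out⁻¹ X) ⟩
      T₁ (μ-step X) ∘ out₁ _ ∘ out₁⁻¹ _                     ≈⟨ refl⟩∘⟨ N₁.C.out∘out⁻¹ _ ⟩
      T₁ (μ-step X) ∘ id                                    ≈⟨ identityʳ ⟩
      T₁ (μ-step X)                                         ∎)

    μ∘embed : ∀ {X} → μ X ∘ N₂.embed X ≈ id
    μ∘embed {X} = N₁.C.hom-unique X (out₁ X) (begin
      out₁ X ∘ μ X ∘ N₂.embed X                        ≈⟨ out∘μ∘ ⟩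
      T₁ (μ-step X) ∘ out₁ _ ∘ out₂ X ∘ N₂.embed X     ≈⟨ refl⟩∘⟨ refl⟩∘⟨ N₂.out∘embed ⟩
      T₁ (μ-step X) ∘ out₁ _ ∘ Tν₁ inl                 ≈⟨ refl⟩∘⟨ N₁.out∘Tν₁ inl ⟩
      T₁ (μ-step X) ∘ T₁ (inl +₁ Tν₁ inl) ∘ out₁ X     ≈⟨ pullˡ T₁∘T₁ ⟩
      T₁ (μ-step X ∘ (inl +₁ Tν₁ inl)) ∘ out₁ X        ≈⟨ T₁-resp (trans μ-step∘+₁ ([]-cong₂ inject₁ refl)) ⟩∘⟨refl ⟩
      T₁ (id +₁ μ X ∘ N₂.embed X) ∘ out₁ X             ∎) (N₁.C.id-isHom X)

    private module Embed = NuMap isM N₁.Tν-isMonad c₁ c₂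

    μ∘embed^ν : ∀ {X} → μ X ∘ at (fam N₁.embed Embed.^ν) X ≈ id
    μ∘embed^ν {X} = N₁.C.hom-unique X (out₁ X) (begin
      out₁ X ∘ μ X ∘ ε                                 ≈⟨ out∘μ∘ ⟩
      T₁ (μ-step X) ∘ out₁ _ ∘ out₂ X ∘ ε              ≈⟨ refl⟩∘⟨ out₁∘out₂∘ε ⟩
      T₁ (μ-step X) ∘ T₁ (inl ∘ (id +₁ ε)) ∘ out₁ X    ≈⟨ pullˡ T₁∘T₁ ⟩
      T₁ (μ-step X ∘ inl ∘ (id +₁ ε)) ∘ out₁ X         ≈⟨ T₁-resp (trans (pullˡ inject₁) id+₁∘id+₁) ⟩∘⟨refl ⟩
      T₁ (id +₁ μ X ∘ ε) ∘ out₁ X                      ∎) (N₁.C.id-isHom X)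
      where
        ε = at (fam N₁.embed Embed.^ν) X
        R = (id +₁ ε) +₁ Tν₁ (id +₁ ε)

        out₁∘out₂∘ε : out₁ _ ∘ out₂ X ∘ ε ≈ T₁ (inl ∘ (id +₁ ε)) ∘ out₁ X
        out₁∘out₂∘ε = begin
          out₁ _ ∘ out₂ X ∘ ε
            ≈⟨ refl⟩∘⟨ Embed.out∘^ν (fam N₁.embed) N₁.embed-isMonadMorphism ⟩
          out₁ _ ∘ Tν₁ (id +₁ ε) ∘ N₁.embed _ ∘ out₁ X
            ≈⟨ trans (pullˡ (N₁.out∘Tν₁ _)) assoc ⟩
          T₁ R ∘ out₁ _ ∘ N₁.embed _ ∘ out₁ X
            ≈⟨ refl⟩∘⟨ pullˡ N₁.out∘embed ⟩
          T₁ R ∘ T₁ inl ∘ out₁ X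
            ≈⟨ pullˡ T₁∘T₁ ⟩
          T₁ (R ∘ inl) ∘ out₁ X
            ≈⟨ T₁-resp inject₁ ⟩∘⟨refl ⟩
          T₁ (inl ∘ (id +₁ ε)) ∘ out₁ X ∎

    μ-unit : ∀ {X} → μ X ∘ N₂.ην ≈ N₁.ην
    μ-unit {X} = N₁.C.out-injective X (begin
      out₁ X ∘ μ X ∘ N₂.ην                        ≈⟨ out∘μ∘ ⟩
      T₁ (μ-step X) ∘ out₁ _ ∘ out₂ X ∘ N₂.ην      ≈⟨ refl⟩∘⟨ refl⟩∘⟨ N₂.out∘ην ⟩
      T₁ (μ-step X) ∘ out₁ _ ∘ N₁.ην ∘ inl         ≈⟨ refl⟩∘⟨ trans (pullˡ N₁.out∘ην) assoc ⟩
      T₁ (μ-step X) ∘ η ∘ inl ∘ inl                ≈⟨ T₁∘η∘ ⟩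
      η ∘ μ-step X ∘ inl ∘ inl                     ≈⟨ refl⟩∘⟨ trans (pullˡ inject₁) (trans inject₁ identityʳ) ⟩
      η ∘ inl                                      ≈⟨ N₁.out∘ην ⟨
      out₁ X ∘ N₁.ην                               ∎)

    μ∘lift-solves : ∀ {X Y} (f : X ⇒ Tνν Y) → N₁.Solves (μ-coalg X) (μ Y ∘ f) (μ Y ∘ N₂.lift f)
    μ∘lift-solves {X} {Y} f = begin
      out₁ Y ∘ μ Y ∘ N₂.lift f
        ≈⟨ out∘μ∘ ⟩
      T₁ (μ-step Y) ∘ out₁ _ ∘ out₂ Y ∘ N₂.lift f
        ≈⟨ refl⟩∘⟨ refl⟩∘⟨ N₂.lift-solves f ⟩
      T₁ (μ-step Y) ∘ out₁ _ ∘ N₁.lift k ∘ out₂ X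
        ≈⟨ refl⟩∘⟨ pullˡ (N₁.lift-solves k) ⟩
      T₁ (μ-step Y) ∘ ([ out₁ _ ∘ k , η ∘ inr ∘ N₁.lift k ] * ∘ out₁ _) ∘ out₂ X
        ≈⟨ trans (refl⟩∘⟨ assoc) (pullˡ *∘*) ⟩
      (T₁ (μ-step Y) ∘ [ out₁ _ ∘ k , η ∘ inr ∘ N₁.lift k ]) * ∘ out₁ _ ∘ out₂ X
        ≈⟨ *-resp-≈ (trans ∘-distribˡ-[] (trans ([]-cong₂ on-out₂∘f on-lift) (sym [A,B]∘[id,inr∘]))) ⟩∘⟨refl ⟩
      ([ A , B ] ∘ [ id , inr ∘ out₂⁻¹ X ]) * ∘ out₁ _ ∘ out₂ X
        ≈⟨ pullˡ *∘T₁ ⟨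
      [ A , B ] * ∘ μ-coalg X ∎
      where
        k = [ out₂ Y ∘ f , N₁.ην ∘ inr ∘ N₂.lift f ]
        A = out₁ Y ∘ μ Y ∘ f
        B = η ∘ inr ∘ μ Y ∘ N₂.lift f

        [A,B]∘[id,inr∘] : [ A , B ] ∘ [ id , inr ∘ out₂⁻¹ X ] ≈ [ [ A , B ] , B ∘ out₂⁻¹ X ]
        [A,B]∘[id,inr∘] = trans ∘-distribˡ-[] ([]-cong₂ identityʳ (pullˡ inject₂))

        on-out₂∘f : T₁ (μ-step Y) ∘ out₁ _ ∘ k ≈ [ A , B ]
        on-out₂∘f = trans (refl⟩∘⟨ ∘-distribˡ-[]) (trans ∘-distribˡ-[] ([]-cong₂
          (sym out∘μ∘)
          (begin
            T₁ (μ-step Y) ∘ out₁ _ ∘ N₁.ην ∘ inr ∘ N₂.lift f ≈⟨ refl⟩∘⟨ trans (pullˡ N₁.out∘ην) assoc ⟩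
            T₁ (μ-step Y) ∘ η ∘ inl ∘ inr ∘ N₂.lift f        ≈⟨ T₁∘η∘ ⟩
            η ∘ μ-step Y ∘ inl ∘ inr ∘ N₂.lift f             ≈⟨ refl⟩∘⟨ trans (pullˡ inject₁) +₁∘inr∘ ⟩
            B                                                ∎)))

        on-lift : T₁ (μ-step Y) ∘ η ∘ inr ∘ N₁.lift k ≈ B ∘ out₂⁻¹ X
        on-lift = begin
          T₁ (μ-step Y) ∘ η ∘ inr ∘ N₁.lift k  ≈⟨ T₁∘η∘ ⟩
          η ∘ μ-step Y ∘ inr ∘ N₁.lift k       ≈⟨ refl⟩∘⟨ trans (pullˡ inject₂) assoc²' ⟩
          η ∘ inr ∘ μ Y ∘ out₂⁻¹ Y ∘ N₁.lift k ≈⟨ refl⟩∘⟨ refl⟩∘⟨ refl⟩∘⟨ N₂.lift∘out⁻¹ f ⟨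
          η ∘ inr ∘ μ Y ∘ N₂.lift f ∘ out₂⁻¹ X ≈⟨ assoc³' ⟨
          B ∘ out₂⁻¹ X                         ∎

    μ-lift : ∀ {X Y} (f : X ⇒ Tνν Y) → μ Y ∘ N₂.lift f ≈ N₁.lift (μ Y ∘ f) ∘ μ X
    μ-lift f = N₁.solution-unique _ _ (μ∘lift-solves f) (N₁.lift∘coit-solves _ _)

    μ-isMonadMorphism : IsMonadMorphism (Nu.triple (Nu.triple M c₁) c₂) (Nu.triple M c₁) μ-fam
    μ-isMonadMorphism = record { unit = μ-unit ; lift = μ-lift }

  module _ {M S : KleisliTriple} (isM : IsMonad M) (isS : IsMonad S)
           (cM₁ : Choice M) (cS₁ : Choice S)
           (cM₂ : Choice (Nu.triple M cM₁)) (cS₂ : Choice (Nu.triple S cS₁))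
           (α : Fam M S) (hα : IsMonadMorphism M S α) where
    private
      module S = KleisliTriple S
      module MM = NuMultiplication isM cM₁ cM₂
      module MS = NuMultiplication isS cS₁ cS₂
      module L₁ = NuMap isM isS cM₁ cS₁
      module L₂ = NuMap MM.N₁.Tν-isMonad MS.N₁.Tν-isMonad cM₂ cS₂
    open KleisliProperties isS
    open MonadMorphismProperties isS α hα

    μ-natural : (α L₁.^ν) ∘F MM.μ-fam ≋ MS.μ-fam ∘F ((α L₁.^ν) L₂.^ν)
    μ-natural X = trans (L₁.^ν∘coit α hα (MM.μ-coalg X)) (sym (MS.N₁.F.coit-unique X _ _ (begin
      MS.N₁.out X ∘ MS.μ X ∘ β
        ≈⟨ MS.out∘μ∘ ⟩
      S.T₁ (MS.μ-step X) ∘ MS.N₁.out _ ∘ MS.N₂.out X ∘ β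
        ≈⟨ refl⟩∘⟨ refl⟩∘⟨ L₂.out∘^ν (α L₁.^ν) (L₁.^ν-isMonadMorphism α hα) ⟩
      S.T₁ (MS.μ-step X) ∘ MS.N₁.out _ ∘ MS.N₁.Tν₁ (id +₁ β) ∘ a _ ∘ MM.N₂.out X
        ≈⟨ refl⟩∘⟨ pullˡ (MS.N₁.out∘Tν₁ _) ⟩
      S.T₁ (MS.μ-step X) ∘ (S.T₁ R ∘ MS.N₁.out _) ∘ a _ ∘ MM.N₂.out X
        ≈⟨ refl⟩∘⟨ pullʳ (L₁.out∘^ν∘ α hα) ⟩
      S.T₁ (MS.μ-step X) ∘ S.T₁ R ∘ S.T₁ (id +₁ a _) ∘ at α _ ∘ MM.N₁.out _ ∘ MM.N₂.out X
        ≈⟨ refl⟩∘⟨ pullˡ T₁∘T₁ ⟩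
      S.T₁ (MS.μ-step X) ∘ S.T₁ (R ∘ (id +₁ a _)) ∘ at α _ ∘ MM.N₁.out _ ∘ MM.N₂.out X
        ≈⟨ pullˡ T₁∘T₁ ⟩
      S.T₁ (MS.μ-step X ∘ R ∘ (id +₁ a _)) ∘ at α _ ∘ MM.N₁.out _ ∘ MM.N₂.out X
        ≈⟨ T₁-resp step-identity ⟩∘⟨refl ⟩
      S.T₁ ((id +₁ MS.μ X ∘ β) ∘ [ id , inr ∘ MM.N₂.out⁻¹ X ]) ∘ at α _ ∘ MM.N₁.out _ ∘ MM.N₂.out X
        ≈⟨ pullˡ T₁∘T₁ ⟨
      S.T₁ (id +₁ MS.μ X ∘ β) ∘ S.T₁ [ id , inr ∘ MM.N₂.out⁻¹ X ] ∘ at α _ ∘ MM.N₁.out _ ∘ MM.N₂.out X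
        ≈⟨ refl⟩∘⟨ α-natural∘ ⟨
      S.T₁ (id +₁ MS.μ X ∘ β) ∘ at α _ ∘ MM.μ-coalg X ∎)))
      where
        a : ∀ Y → MM.N₁.Tν Y ⇒ MS.N₁.Tν Y
        a = at (α L₁.^ν)
        β = at ((α L₁.^ν) L₂.^ν) X
        R = (id +₁ β) +₁ MS.N₁.Tν₁ (id +₁ β)

        step-identity : MS.μ-step X ∘ R ∘ (id +₁ a _) ≈ (id +₁ MS.μ X ∘ β) ∘ [ id , inr ∘ MM.N₂.out⁻¹ X ]
        step-identity = begin
          MS.μ-step X ∘ R ∘ (id +₁ a _)
            ≈⟨ pullˡ MS.μ-step∘+₁ ⟩
          [ (id +₁ MS.μ X) ∘ (id +₁ β) , inr ∘ MS.μ X ∘ MS.N₂.out⁻¹ X ∘ MS.N₁.Tν₁ (id +₁ β) ] ∘ (id +₁ a _)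
            ≈⟨ trans []∘+₁ ([]-cong₂ (trans identityʳ id+₁∘id+₁) assoc³') ⟩
          [ id +₁ MS.μ X ∘ β , inr ∘ MS.μ X ∘ MS.N₂.out⁻¹ X ∘ MS.N₁.Tν₁ (id +₁ β) ∘ a _ ]
            ≈⟨ []-cong₂ refl (refl⟩∘⟨ refl⟩∘⟨ L₂.^ν∘out⁻¹ (α L₁.^ν) (L₁.^ν-isMonadMorphism α hα)) ⟨
          [ id +₁ MS.μ X ∘ β , inr ∘ MS.μ X ∘ β ∘ MM.N₂.out⁻¹ X ]
            ≈⟨ trans id+₁∘[id,inr∘] ([]-cong₂ refl (refl⟩∘⟨ assoc)) ⟨
          (id +₁ MS.μ X ∘ β) ∘ [ id , inr ∘ MM.N₂.out⁻¹ X ] ∎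

  module _ {M : KleisliTriple} (isM : IsMonad M) (c₁ : Choice M) (c₂ : Choice (Nu.triple M c₁))
           (c₃ : Choice (Nu.triple (Nu.triple M c₁) c₂)) where
    private
      module U₁ = NuMultiplication isM c₁ c₂
      module U₂ = NuMultiplication U₁.N₁.Tν-isMonad c₂ c₃
      module L = NuMap U₁.N₂.Tν-isMonad U₁.N₁.Tν-isMonad c₃ c₂
    open KleisliTriple M
    open KleisliProperties isM
    open U₁ using (μ; μ-fam; μ-step)
    open U₁.N₁ using (Tν₁) renaming (out to out₁)
    open U₁.N₂ using () renaming (out to out₂; out⁻¹ to out₂⁻¹)
    open U₂.N₂ using () renaming (Tν to Tννν; out to out₃; out⁻¹ to out₃⁻¹)

    μ-assoc : μ-fam ∘F U₂.μ-fam ≋ μ-fam ∘F (μ-fam L.^ν)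
    μ-assoc X = U₁.N₁.C.hom-unique X (T₁ Ψ ∘ W) (isHom-factor unfold-μ∘μ) (isHom-factor unfold-μ∘ρ)
      where
        Z = X + Tννν X
        ρ = at (μ-fam L.^ν) X
        W = out₁ _ ∘ out₂ Z ∘ out₃ X
        Ψ = [ [ id , inr ∘ out₃⁻¹ X ] , inr ∘ out₃⁻¹ X ∘ out₂⁻¹ Z ]

        isHom-factor : ∀ {h} → out₁ X ∘ h ≈ T₁ ((id +₁ h) ∘ Ψ) ∘ W → U₁.N₁.C.IsHom X (T₁ Ψ ∘ W) h
        isHom-factor p = trans p (sym (pullˡ T₁∘T₁))

        id+₁∘Ψ : ∀ {h} → (id +₁ h) ∘ Ψ ≈ [ [ id +₁ h , inr ∘ h ∘ out₃⁻¹ X ] , inr ∘ h ∘ out₃⁻¹ X ∘ out₂⁻¹ Z ]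
        id+₁∘Ψ = trans ∘-distribˡ-[] ([]-cong₂ id+₁∘[id,inr∘] +₁∘inr∘)

        unfold-μ∘μ : out₁ X ∘ μ X ∘ U₂.μ X ≈ T₁ ((id +₁ μ X ∘ U₂.μ X) ∘ Ψ) ∘ W
        unfold-μ∘μ = begin
          out₁ X ∘ μ X ∘ U₂.μ X
            ≈⟨ U₁.out∘μ∘ ⟩
          T₁ (μ-step X) ∘ out₁ _ ∘ out₂ X ∘ U₂.μ X
            ≈⟨ refl⟩∘⟨ refl⟩∘⟨ U₂.out∘μ ⟩
          T₁ (μ-step X) ∘ out₁ _ ∘ Tν₁ (U₂.μ-step X) ∘ out₂ Z ∘ out₃ X
            ≈⟨ refl⟩∘⟨ trans (pullˡ (U₁.N₁.out∘Tν₁ _)) assoc ⟩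
          T₁ (μ-step X) ∘ T₁ (U₂.μ-step X +₁ Tν₁ (U₂.μ-step X)) ∘ W
            ≈⟨ pullˡ T₁∘T₁ ⟩
          T₁ (μ-step X ∘ (U₂.μ-step X +₁ Tν₁ (U₂.μ-step X))) ∘ W
            ≈⟨ T₁-resp step-identity ⟩∘⟨refl ⟩
          T₁ ((id +₁ μ X ∘ U₂.μ X) ∘ Ψ) ∘ W ∎
          where
            step-identity : μ-step X ∘ (U₂.μ-step X +₁ Tν₁ (U₂.μ-step X)) ≈ (id +₁ μ X ∘ U₂.μ X) ∘ Ψ
            step-identity = trans U₁.μ-step∘+₁ (trans ([]-cong₂
              (trans ∘-distribˡ-[] ([]-cong₂ id+₁∘id+₁ (trans +₁∘inr∘ (refl⟩∘⟨ sym-assoc))))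
              (refl⟩∘⟨ trans (refl⟩∘⟨ sym U₂.μ∘out⁻¹) sym-assoc)) (sym id+₁∘Ψ))

        unfold-μ∘ρ : out₁ X ∘ μ X ∘ ρ ≈ T₁ ((id +₁ μ X ∘ ρ) ∘ Ψ) ∘ W
        unfold-μ∘ρ = begin
          out₁ X ∘ μ X ∘ ρ
            ≈⟨ U₁.out∘μ∘ ⟩
          T₁ (μ-step X) ∘ out₁ _ ∘ out₂ X ∘ ρ
            ≈⟨ refl⟩∘⟨ refl⟩∘⟨ L.out∘^ν μ-fam U₁.μ-isMonadMorphism ⟩
          T₁ (μ-step X) ∘ out₁ _ ∘ Tν₁ (id +₁ ρ) ∘ μ Z ∘ out₃ X
            ≈⟨ refl⟩∘⟨ trans (pullˡ (U₁.N₁.out∘Tν₁ _)) assoc ⟩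
          T₁ (μ-step X) ∘ T₁ R ∘ out₁ _ ∘ μ Z ∘ out₃ X
            ≈⟨ refl⟩∘⟨ refl⟩∘⟨ U₁.out∘μ∘ ⟩
          T₁ (μ-step X) ∘ T₁ R ∘ T₁ (μ-step Z) ∘ W
            ≈⟨ refl⟩∘⟨ pullˡ T₁∘T₁ ⟩
          T₁ (μ-step X) ∘ T₁ (R ∘ μ-step Z) ∘ W
            ≈⟨ pullˡ T₁∘T₁ ⟩
          T₁ (μ-step X ∘ R ∘ μ-step Z) ∘ W
            ≈⟨ T₁-resp step-identity ⟩∘⟨refl ⟩
          T₁ ((id +₁ μ X ∘ ρ) ∘ Ψ) ∘ W ∎
          where
            R = (id +₁ ρ) +₁ Tν₁ (id +₁ ρ)
            q = inr ∘ μ X ∘ out₂⁻¹ X ∘ Tν₁ (id +₁ ρ)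

            q∘μ : q ∘ μ Z ≈ inr ∘ (μ X ∘ ρ) ∘ out₃⁻¹ X
            q∘μ = begin
              q ∘ μ Z
                ≈⟨ assoc³' ⟩
              inr ∘ μ X ∘ out₂⁻¹ X ∘ Tν₁ (id +₁ ρ) ∘ μ Z
                ≈⟨ refl⟩∘⟨ refl⟩∘⟨ L.^ν∘out⁻¹ μ-fam U₁.μ-isMonadMorphism ⟨
              inr ∘ μ X ∘ ρ ∘ out₃⁻¹ X
                ≈⟨ refl⟩∘⟨ sym-assoc ⟩
              inr ∘ (μ X ∘ ρ) ∘ out₃⁻¹ X ∎

            step-identity : μ-step X ∘ R ∘ μ-step Z ≈ (id +₁ μ X ∘ ρ) ∘ Ψ
            step-identity = begin
              μ-step X ∘ R ∘ μ-step Z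
                ≈⟨ pullˡ U₁.μ-step∘+₁ ⟩
              [ (id +₁ μ X) ∘ (id +₁ ρ) , q ] ∘ μ-step Z
                ≈⟨ trans ∘-distribˡ-[] ([]-cong₂ []∘+₁ (pullˡ inject₂)) ⟩
              [ [ ((id +₁ μ X) ∘ (id +₁ ρ)) ∘ id , q ∘ μ Z ] , q ∘ μ Z ∘ out₂⁻¹ Z ]
                ≈⟨ []-cong₂ ([]-cong₂ (trans identityʳ id+₁∘id+₁) q∘μ) (trans (pullˡ q∘μ) assoc²') ⟩
              [ [ id +₁ μ X ∘ ρ , inr ∘ (μ X ∘ ρ) ∘ out₃⁻¹ X ] , inr ∘ (μ X ∘ ρ) ∘ out₃⁻¹ X ∘ out₂⁻¹ Z ]
                ≈⟨ id+₁∘Ψ ⟨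
              (id +₁ μ X ∘ ρ) ∘ Ψ ∎

lemma5p14 : ∀ {o ℓ e} (𝒞 : Category o ℓ e) (FC : FiniteCoproducts 𝒞) →
    Theory.NuIsMonad FC
lemma5p14 𝒞 FC = record
  { ν-isMonad = λ A → NuProperties.Tν-isMonad (isMonad A) (fc (iter A))
  ; ν-hom     = λ A B → NuMap.^ν-isMonadMorphism (isMonad A) (isMonad B) (fc (iter A)) (fc (iter B))
  ; ν-resp    = λ A B _ _ _ _ → NuMap.^ν-resp (isMonad A) (isMonad B) (fc (iter A)) (fc (iter B))
  ; ν-id      = λ A → ^ν-identity (isMonad A) (fc (iter A))
  ; ν-∘       = λ A B C α β _ → ^ν-∘ (isMonad A) (isMonad B) (isMonad C)
                                     (fc (iter A)) (fc (iter B)) (fc (iter C)) α β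
  ; η-hom     = λ A → NuProperties.embed-isMonadMorphism (isMonad A) (fc (iter A))
  ; η-nat     = λ A B α hα _ → NuMap.^ν∘embed (isMonad A) (isMonad B) (fc (iter A)) (fc (iter B)) α hα
  ; μ-hom     = λ A → NuMultiplication.μ-isMonadMorphism (isMonad A) (fc (iter A)) (fc (next (iter A)))
  ; μ-nat     = λ A B → μ-natural (isMonad A) (isMonad B) (fc (iter A)) (fc (iter B))
                                  (fc (next (iter A))) (fc (next (iter B)))
  ; unitˡ     = λ A _ → NuMultiplication.μ∘embed (isMonad A) (fc (iter A)) (fc (next (iter A)))
  ; unitʳ     = λ A _ → NuMultiplication.μ∘embed^ν (isMonad A) (fc (iter A)) (fc (next (iter A)))
  ; assoc-μ   = λ A → μ-assoc (isMonad A) (fc (iter A)) (fc (next (iter A))) (fc (next (next (iter A))))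
  }
  where
    open Theory FC
    open NuMonad FC
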